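{- For all positive integers $n$ and $k$, the comb $P_n\odot K_1$ is a $k$-geometric mean graph.
   Context: The comb $P_n\odot K_1$ is the graph obtained from the path $P_n$ on $n$ vertices by attaching to each vertex of the path one new pendant vertex (the corona $G_1\odot G_2$ of a graph $G_1$ with $p$ vertices and a graph $G_2$ is obtained from one copy of $G_1$ and $p$ copies of $G_2$ by joining the $i$-th vertex of $G_1$ to every vertex of the $i$-th copy of $G_2$). Let $k$ be a positive integer. A finite simple graph $G$ with $p$ vertices and $q$ edges is a $k$-geometric mean graph if there is an injection $\psi: V(G)\to\{k,k+1,\dots,k+q\}$ such that, when each edge $uv$ is assigned one of the labels $\lfloor\sqrt{\psi(u)\psi(v)}\rfloor$ or $\lceil\sqrt{\psi(u)\psi(v)}\rceil$ (chosen per edge), the resulting set of edge labels is exactly $\{k,k+1,\dots,k+q-1\}$. -}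

module Defs where

open import Data.Nat using (ℕ; zero; suc; _+_; _*_; _≤_; _<_)
open import Data.Fin using (Fin; inject₁; splitAt)
open import Data.Sum using (_⊎_; inj₁; inj₂)
open import Data.Product using (_×_; _,_; Σ; ∃)
open import Relation.Binary.PropositionalEquality using (_≡_)
open import Function.Definitions using (Injective)

record Graph : Set₁ where
  field
    V    : Set
    q    : ℕ
    edge : Fin q → V × V

IsFloorSqrt : ℕ → ℕ → Set
IsFloorSqrt m ℓ = (ℓ * ℓ ≤ m) × (m < suc ℓ * suc ℓ)

IsCeilSqrt : ℕ → ℕ → Set
IsCeilSqrt m zero    = m ≡ 0
IsCeilSqrt m (suc j) = (j * j < m) × (m ≤ suc j * suc j)

AdmissibleLabel : ℕ → ℕ → ℕ → Set
AdmissibleLabel a b ℓ = IsFloorSqrt (a * b) ℓ ⊎ IsCeilSqrt (a * b) ℓ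

IsKGeometricMean : ℕ → Graph → Set
IsKGeometricMean k G =
  Σ (V → ℕ) λ ψ →
    Injective _≡_ _≡_ ψ
    × (∀ v → k ≤ ψ v × ψ v ≤ k + q)
    × Σ (Fin q → ℕ) λ f →
        (∀ i → AdmissibleLabel (ψ (Data.Product.proj₁ (edge i)))
                               (ψ (Data.Product.proj₂ (edge i))) (f i))
        × (∀ i → k ≤ f i × f i < k + q)
        × (∀ ℓ → k ≤ ℓ → ℓ < k + q → ∃ λ i → f i ≡ ℓ)
  where open Graph G

-- The comb P_{suc m} ⊙ K₁: vertices (inj₁ i) on the path, (inj₂ i) the
-- pendant vertex attached to path vertex i.
-- Edges: Fin (m + suc m); first m are path edges, last suc m pendant edges.
combEdge : (m : ℕ) → Fin (m + suc m) → (Fin (suc m) ⊎ Fin (suc m)) × (Fin (suc m) ⊎ Fin (suc m))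
combEdge m e with splitAt m e
... | inj₁ j = inj₁ (inject₁ j) , inj₁ (Fin.suc j)
... | inj₂ i = inj₁ i , inj₂ i

-- comb n = P_n ⊙ K₁ for n ≥ 1 (n = suc m)
comb : (m : ℕ) → Graph
comb m = record { V = Fin (suc m) ⊎ Fin (suc m) ; q = m + suc m ; edge = combEdge m }

module Submission where

-- Path vertex i gets the odd label k + (2i+1) and its pendant vertex the
-- even label k + 2i; so the vertex labels are k, …, k + 2m + 1 = k + q,
-- all distinct.  Every edge is labelled by the floor of the geometric
-- mean of its endpoint labels, which is a near-square:
--   path edge i — i+1   : (k+2i+1)(k+2i+3) has floor square root k+2i+1,
--   pendant edge at i   : (k+2i+1)(k+2i)   has floor square root k+2i.
-- Hence edge labels are k + r where r runs over the odd numbers below 2m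
-- (path edges) and the even numbers up to 2m (pendant edges), i.e. over
-- exactly {k, …, k + q - 1}.

open import Defs
open import Data.Nat using (ℕ; zero; suc; _+_; _*_; _∸_; _≤_; _<_; z≤n; s≤s; s≤s⁻¹)
open import Data.Nat.Properties
open import Data.Fin using (Fin; toℕ; splitAt; join; fromℕ<)
open import Data.Fin.Properties using (toℕ<n; toℕ-injective; toℕ-inject₁; toℕ-fromℕ<; splitAt-join)
open import Data.Sum as Sum using (_⊎_; inj₁; inj₂)
open import Data.Sum.Properties using (inj₁-injective; inj₂-injective)
open import Data.Product using (_×_; _,_; ∃; proj₁; proj₂)
open import Relation.Binary.PropositionalEquality
open import Function.Definitions using (Injective)
open import Function.Base using (_∘_)
open import Data.Nat.Tactic.RingSolver using (solve-∀)

-- ⌊√(n(n+d))⌋ = n as long as d ≤ 2, since n(n+2) = (n+1)² - 1.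
floorSqrt-nearSquare : ∀ n d → d ≤ 2 → IsFloorSqrt (n * (d + n)) n
floorSqrt-nearSquare n d d≤2 = *-monoʳ-≤ n (m≤n+m n d) , below-next-square
  where
  below-next-square : n * (d + n) < suc n * suc n
  below-next-square = ≤-<-trans (*-monoʳ-≤ n (+-monoˡ-≤ n d≤2))
                                (s≤s (≤-reflexive (*-suc n (suc n))))

interleave : ℕ ⊎ ℕ → ℕ
interleave (inj₁ i) = suc (2 * i)
interleave (inj₂ i) = 2 * i

successor : ℕ ⊎ ℕ → ℕ ⊎ ℕ
successor (inj₁ i) = inj₂ (suc i)
successor (inj₂ i) = inj₁ i

deinterleave : ℕ → ℕ ⊎ ℕ
deinterleave zero    = inj₂ zero
deinterleave (suc n) = successor (deinterleave n)

interleave-deinterleave : ∀ n → interleave (deinterleave n) ≡ n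
interleave-deinterleave zero = refl
interleave-deinterleave (suc n) with deinterleave n | interleave-deinterleave n
... | inj₁ i | refl = *-suc 2 i
... | inj₂ i | refl = refl

deinterleave-double : ∀ i → deinterleave (2 * i) ≡ inj₂ i
deinterleave-double zero = refl
deinterleave-double (suc i) = begin
  deinterleave (2 * suc i)                        ≡⟨ cong deinterleave (*-suc 2 i) ⟩
  successor (successor (deinterleave (2 * i)))    ≡⟨ cong (successor ∘ successor) (deinterleave-double i) ⟩
  inj₂ (suc i)                                    ∎
  where open ≡-Reasoning

deinterleave-interleave : ∀ x → deinterleave (interleave x) ≡ x
deinterleave-interleave (inj₁ i) rewrite deinterleave-double i = refl
deinterleave-interleave (inj₂ i) = deinterleave-double i

interleave-injective : Injective _≡_ _≡_ interleave
interleave-injective {x} {y} e = begin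
  x                            ≡⟨ sym (deinterleave-interleave x) ⟩
  deinterleave (interleave x)  ≡⟨ cong deinterleave e ⟩
  deinterleave (interleave y)  ≡⟨ deinterleave-interleave y ⟩
  y                            ∎
  where open ≡-Reasoning

toℕ⊎ : ∀ {a b} → Fin a ⊎ Fin b → ℕ ⊎ ℕ
toℕ⊎ = Sum.map toℕ toℕ

toℕ⊎-injective : ∀ {a b} → Injective _≡_ _≡_ (toℕ⊎ {a} {b})
toℕ⊎-injective {x = inj₁ i} {inj₁ j} e = cong inj₁ (toℕ-injective (inj₁-injective e))
toℕ⊎-injective {x = inj₂ i} {inj₂ j} e = cong inj₂ (toℕ-injective (inj₂-injective e))
toℕ⊎-injective {x = inj₁ i} {inj₂ j} ()
toℕ⊎-injective {x = inj₂ i} {inj₁ j} ()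

interleave-bounded : ∀ {m} (x : Fin m ⊎ Fin (suc m)) → interleave (toℕ⊎ x) < suc (2 * m)
interleave-bounded (inj₁ a) = s≤s (*-monoʳ-< 2 (toℕ<n a))
interleave-bounded (inj₂ i) = s≤s (*-monoʳ-≤ 2 (s≤s⁻¹ (toℕ<n i)))

interleave-onto : ∀ {m} n → n < suc (2 * m) →
                  ∃ λ (x : Fin m ⊎ Fin (suc m)) → interleave (toℕ⊎ x) ≡ n
interleave-onto {m} n n≤2m with deinterleave n | interleave-deinterleave n
... | inj₁ i | refl = inj₁ (fromℕ< i<m) , cong (suc ∘ (2 *_)) (toℕ-fromℕ< i<m)
  where
  i<m : i < m
  i<m = *-cancelˡ-< 2 i m (s≤s⁻¹ n≤2m)
... | inj₂ i | refl = inj₂ (fromℕ< i≤m) , cong (2 *_) (toℕ-fromℕ< i≤m)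
  where
  i≤m : i < suc m
  i≤m = s≤s (*-cancelˡ-≤ 2 (s≤s⁻¹ n≤2m))

interleave-vertexBounded : ∀ {m} (x : Fin (suc m) ⊎ Fin (suc m)) → interleave (toℕ⊎ x) ≤ suc (2 * m)
interleave-vertexBounded (inj₁ i) = s≤s (*-monoʳ-≤ 2 (s≤s⁻¹ (toℕ<n i)))
interleave-vertexBounded (inj₂ i) = m≤n⇒m≤1+n (*-monoʳ-≤ 2 (s≤s⁻¹ (toℕ<n i)))

module CombLabelling (m k : ℕ) where

  combSize : m + suc m ≡ suc (2 * m)
  combSize = trans (+-suc m m) (cong (λ n → suc (m + n)) (sym (+-identityʳ m)))

  vertexLabel : Fin (suc m) ⊎ Fin (suc m) → ℕ
  vertexLabel v = k + interleave (toℕ⊎ v)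

  edgeLabel : Fin (m + suc m) → ℕ
  edgeLabel e = k + interleave (toℕ⊎ (splitAt m e))

  vertexLabel-injective : Injective _≡_ _≡_ vertexLabel
  vertexLabel-injective e = toℕ⊎-injective (interleave-injective (+-cancelˡ-≡ k _ _ e))

  vertexLabel-range : ∀ v → k ≤ vertexLabel v × vertexLabel v ≤ k + (m + suc m)
  vertexLabel-range v = m≤m+n k _ ,
    +-monoʳ-≤ k (≤-trans (interleave-vertexBounded v) (≤-reflexive (sym combSize)))

  -- (k+2t+1)(k+2t+3) = n(n+2) for n = k+2t+1.
  pathEdge-floor : ∀ t → IsFloorSqrt ((k + suc (2 * t)) * (k + suc (2 * suc t))) (k + suc (2 * t))
  pathEdge-floor t = subst (λ c → IsFloorSqrt ((k + suc (2 * t)) * c) (k + suc (2 * t)))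
                           (sym (twoMore k t))
                           (floorSqrt-nearSquare (k + suc (2 * t)) 2 ≤-refl)
    where
    twoMore : ∀ k t → k + suc (2 * suc t) ≡ 2 + (k + suc (2 * t))
    twoMore = solve-∀

  -- (k+2t+1)(k+2t) = n(n+1) for n = k+2t.
  pendantEdge-floor : ∀ t → IsFloorSqrt ((k + suc (2 * t)) * (k + 2 * t)) (k + 2 * t)
  pendantEdge-floor t = subst (λ x → IsFloorSqrt x n) reorder (floorSqrt-nearSquare n 1 (s≤s z≤n))
    where
    n = k + 2 * t
    reorder : n * (1 + n) ≡ (k + suc (2 * t)) * n
    reorder = trans (*-comm n (suc n)) (cong (_* n) (sym (+-suc k (2 * t))))

  edgeLabel-admissible : ∀ e → AdmissibleLabel (vertexLabel (proj₁ (combEdge m e)))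
                                                (vertexLabel (proj₂ (combEdge m e))) (edgeLabel e)
  edgeLabel-admissible e with splitAt m e
  ... | inj₁ a rewrite toℕ-inject₁ a = inj₁ (pathEdge-floor (toℕ a))
  ... | inj₂ i = inj₁ (pendantEdge-floor (toℕ i))

  edgeLabel-range : ∀ e → k ≤ edgeLabel e × edgeLabel e < k + (m + suc m)
  edgeLabel-range e = m≤m+n k _ ,
    +-monoʳ-< k (subst (interleave (toℕ⊎ (splitAt m e)) <_) (sym combSize) (interleave-bounded (splitAt m e)))

  -- Every ℓ in {k, …, k + q - 1} is the label of the edge coded by ℓ - k.
  edgeLabel-onto : ∀ ℓ → k ≤ ℓ → ℓ < k + (m + suc m) → ∃ λ e → edgeLabel e ≡ ℓ
  edgeLabel-onto ℓ k≤ℓ ℓ<k+q with interleave-onto (ℓ ∸ k) offset<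
    where
    offset< : ℓ ∸ k < suc (2 * m)
    offset< = +-cancelˡ-< k _ _ (subst₂ _<_ (sym (m+[n∸m]≡n k≤ℓ)) (cong (k +_) combSize) ℓ<k+q)
  ... | x , code≡ = join m (suc m) x , (begin
    k + interleave (toℕ⊎ (splitAt m (join m (suc m) x)))  ≡⟨ cong (λ y → k + interleave (toℕ⊎ y)) (splitAt-join m (suc m) x) ⟩
    k + interleave (toℕ⊎ x)                               ≡⟨ cong (k +_) code≡ ⟩
    k + (ℓ ∸ k)                                           ≡⟨ m+[n∸m]≡n k≤ℓ ⟩
    ℓ                                                     ∎)
    where open ≡-Reasoning

comb-isGeometricMean : ∀ m k → IsKGeometricMean k (comb m)
comb-isGeometricMean m k =
  vertexLabel , vertexLabel-injective , vertexLabel-range ,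
  edgeLabel , edgeLabel-admissible , edgeLabel-range , edgeLabel-onto
  where open CombLabelling m k

mainTheorem7 : (m j : ℕ) → IsKGeometricMean (suc j) (comb m)
mainTheorem7 m j = comb-isGeometricMean m (suc j)
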